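{- Let $(V,\mathcal{B})$ be a $(v,k,1)$-BIBD with well-distributed minimal sub-BIBDs, whose minimal sub-BIBDs are $(v',k,1)$-BIBDs; let $n$ be the number of minimal sub-BIBDs and $b=|\mathcal{B}|$. (1) If no two distinct minimal sub-BIBDs intersect in exactly one point, then $n<b$. (2) If $v'>k^{2}-k+1$ and no two distinct minimal sub-BIBDs are disjoint, then $n<b$.
   Context: A $(v,k,\lambda)$-BIBD is a pair $(V,\mathcal{B})$ where $V$ is a finite set of $v$ points and $\mathcal{B}$ is a set (no repeated blocks) of $k$-subsets of $V$, $k>1$, such that every pair of distinct points lies in exactly $\lambda$ blocks; trivial cases are excluded (in particular $\mathcal{B}$ is not the set of all $k$-subsets of $V$, so $k\geq 3$). A sub-BIBD of a $(v,k,1)$-BIBD $(V,\mathcal{B})$ is a pair $(V',\mathcal{B}')$ with $V'\subseteq V$, $\mathcal{B}'\subseteq\{B\in\mathcal{B}:B\subseteq V'\}$, which is itself a $(v',k,1)$-BIBD. A sub-BIBD is minimal if $v'$ is minimal among all sub-BIBDs with $v'>k$. $(V,\mathcal{B})$ has well-distributed minimal sub-BIBDs if there are integers $l,m$ such that every point lies in exactly $l$ minimal sub-BIBDs and every block lies in exactly $m$ minimal sub-BIBDs. -}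

module Defs where

open import Data.Nat using (ℕ; _<_; _≤_; _*_; _∸_; _+_)
open import Data.Fin using (Fin)
open import Data.Fin.Subset using (Subset; _∈_; _⊆_; ∣_∣; ⊤; _∩_; Empty)
open import Data.Fin.Subset.Properties using (_∈?_)
open import Data.Vec using (Vec; lookup)
open import Data.List using (List; length; filter; allFin)
open import Data.List.Relation.Unary.Unique.Propositional using (Unique)
open import Data.List.Membership.Propositional renaming (_∈_ to _∈ˡ_)
open import Data.Product using (_×_; Σ; ∃; proj₁; proj₂)
open import Relation.Nullary using (¬_; _×-dec_)
open import Relation.Binary.PropositionalEquality using (_≡_; _≢_)
open import Function.Bundles using (_⇔_)
open import Function.Definitions using (Injective)

-- Point set of the ambient design: Fin v.  Blocks: an indexed family
-- blocks : Vec (Subset v) b  (b = number of blocks); "no repeated blocks"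
-- is injectivity of  lookup blocks.

pairCount : ∀ {v b} → Vec (Subset v) b → Subset b → Fin v → Fin v → ℕ
pairCount blocks B x y =
  length (filter (λ i → (i ∈? B) ×-dec ((x ∈? lookup blocks i) ×-dec (y ∈? lookup blocks i))) (allFin _))

-- (V , {blocks i | i ∈ B}) is a (|V|, k, λ)-BIBD, trivial cases excluded:
-- k > 1, and not every k-subset of V is a block.
IsBIBDOn : ∀ {v b} → Vec (Subset v) b → Subset v → Subset b → ℕ → ℕ → Set
IsBIBDOn blocks V B k lam =
  (1 < k) ×
  (∀ i → i ∈ B → lookup blocks i ⊆ V) ×
  (∀ i → i ∈ B → ∣ lookup blocks i ∣ ≡ k) ×
  (∀ x y → x ∈ V → y ∈ V → x ≢ y → pairCount blocks B x y ≡ lam) ×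
  (∃ λ (S : Subset _) → S ⊆ V × ∣ S ∣ ≡ k × (∀ i → i ∈ B → lookup blocks i ≢ S))

IsBIBD : ∀ {v b} → Vec (Subset v) b → ℕ → Set
IsBIBD {v} {b} blocks k = Injective _≡_ _≡_ (lookup blocks) × IsBIBDOn blocks ⊤ ⊤ k 1

SubDesign : ℕ → ℕ → Set
SubDesign v b = Subset v × Subset b

points : ∀ {v b} → SubDesign v b → Subset v
points = proj₁

blockIdx : ∀ {v b} → SubDesign v b → Subset b
blockIdx = proj₂

IsSubBIBD : ∀ {v b} → Vec (Subset v) b → ℕ → SubDesign v b → Set
IsSubBIBD blocks k s = IsBIBDOn blocks (points s) (blockIdx s) k 1

IsMinimalSubBIBD : ∀ {v b} → Vec (Subset v) b → ℕ → SubDesign v b → Set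
IsMinimalSubBIBD blocks k s =
  IsSubBIBD blocks k s × (k < ∣ points s ∣) ×
  (∀ t → IsSubBIBD blocks k t → k < ∣ points t ∣ → ∣ points s ∣ ≤ ∣ points t ∣)

EnumeratesMinimal : ∀ {v b} → Vec (Subset v) b → ℕ → List (SubDesign v b) → Set
EnumeratesMinimal blocks k L =
  Unique L × (∀ s → (s ∈ˡ L) ⇔ IsMinimalSubBIBD blocks k s)

countPoint : ∀ {v b} → List (SubDesign v b) → Fin v → ℕ
countPoint L x = length (filter (λ s → x ∈? points s) L)

countBlock : ∀ {v b} → List (SubDesign v b) → Fin b → ℕ
countBlock L i = length (filter (λ s → i ∈? blockIdx s) L)

WellDistributed : ∀ {v b} → List (SubDesign v b) → Set
WellDistributed {v} {b} L =
  Σ ℕ λ l → Σ ℕ λ m → (∀ (x : Fin v) → countPoint L x ≡ l) × (∀ (i : Fin b) → countBlock L i ≡ m)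

module Submission where

-- Double counting incidences between blocks and minimal sub-BIBDs gives
-- n (m + 1) ≤ b m as soon as every minimal sub-BIBD has more than m blocks,
-- whence n < b ('fewer-than-blocks').  So it suffices to find, for every
-- minimal S, a block lying in fewer minimal sub-BIBDs than S has blocks.
-- The structural tool is rigidity ('minimal-rigid'): two minimal sub-BIBDs
-- sharing a block and a point off it coincide, since their meet is again a
-- sub-BIBD with more than k points.
--   (1) If distinct minimal sub-BIBDs never meet in exactly one point, some
--       block lies in at most r_S(p) of them (p a point of S), and r_S(p) < |B_S|.
--   (2) If v' > k² - k + 1 and they pairwise meet, some block lies in at most
--       v' of them, and v' < |B_S| by a Fisher-type bound.

open import Defs
open import Data.Nat using (ℕ; zero; suc; _+_; _*_; _∸_; _≤_; _<_; z≤n; s≤s; _≤?_)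
open import Data.Nat.Properties
  using (≤-trans; ≤-<-trans; <-trans; ≤∧≢⇒<; ≰⇒>; *-suc; m<n+m; *-cancelʳ-<; +-*-semiring; module ≤-Reasoning)
open import Algebra.Properties.Semiring.Sum +-*-semiring using (sum; sum-cong-≗)
open import Data.Fin using (Fin)
open import Data.Fin.Properties using (any?)
open import Data.Fin.Subset using (Subset; _∈_; _∉_; ∣_∣; _∩_; Empty)
open import Data.Fin.Subset.Properties using (_∈?_; x∈p∩q⁺; x∈p∩q⁻; nonempty?)
open import Data.Vec using (Vec)
open import Data.List using (List; length; filter)
open import Data.List.Properties using (length-filter)
open import Data.List.Membership.Propositional using () renaming (_∈_ to _∈ˡ_)
open import Data.List.Membership.Propositional.Properties using (∈-filter⁻)
open import Data.List.Relation.Unary.Unique.Propositional.Properties using (filter⁺)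
open import Data.Product using (_×_; ∃; proj₁; proj₂; _,_)
open import Function using (_∘_)
open import Function.Bundles using (Equivalence)
open import Relation.Nullary using (¬_; Dec; yes; no; ¬?; _×-dec_; contradiction)
open import Relation.Nullary.Decidable using (decidable-stable)
open import Relation.Unary using (Decidable)
open import Relation.Binary.PropositionalEquality using (_≡_; _≢_; refl; sym; trans; subst)

module Counting where

  open import Data.Nat.Properties
    using (m<m+n; ≤-refl; ≤-antisym; +-mono-≤; <⇒≱; *-zeroʳ; *-identityʳ)
  open import Algebra.Properties.Semiring.Sum +-*-semiring
    using (sum-replicate-zero; ∑-distrib-+; *-distribˡ-sum)
  open import Data.Fin using (zero; suc; _≟_)
  open import Data.Fin.Subset using (inside; outside; ⁅_⁆)
  open import Data.Fin.Subset.Properties using (drop-there; ∣⁅x⁆∣≡1; x∈⁅x⁆; x∈⁅y⁆⇒x≡y)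
  open import Data.Vec using ([]; _∷_; _[_]=_)
  open _[_]=_ using (there)
  open import Data.List using (_∷_; []; allFin; tabulate)
  open import Data.List.Relation.Unary.Unique.Propositional using (Unique)
  open import Data.List.Relation.Unary.Unique.Propositional.Properties using (allFin⁺)
  open import Data.List.Relation.Unary.AllPairs using (_∷_)
  open import Data.List.Relation.Unary.All as All using ()
  open import Data.List.Relation.Unary.Any using () renaming (here to hereˡ; there to thereˡ)
  open import Data.Empty using (⊥)
  open import Function using (id)
  open import Relation.Binary.PropositionalEquality using (cong; module ≡-Reasoning)

  𝟙 : ∀ {p} {P : Set p} → Dec P → ℕ
  𝟙 (yes _) = 1
  𝟙 (no _)  = 0

  𝟙-no : ∀ {p} {P : Set p} (d : Dec P) → ¬ P → 𝟙 d ≡ 0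
  𝟙-no (yes p) ¬p = contradiction p ¬p
  𝟙-no (no _)  _  = refl

  𝟙-mono : ∀ {p q} {P : Set p} {Q : Set q} (d : Dec P) (e : Dec Q) → (P → Q) → 𝟙 d ≤ 𝟙 e
  𝟙-mono (yes p) (yes _) _ = ≤-refl
  𝟙-mono (yes p) (no ¬q) f = contradiction (f p) ¬q
  𝟙-mono (no _)  _       _ = z≤n

  sum-mono : ∀ {m} {f g : Fin m → ℕ} → (∀ i → f i ≤ g i) → sum f ≤ sum g
  sum-mono {zero}  _ = z≤n
  sum-mono {suc m} h = +-mono-≤ (h zero) (sum-mono (h ∘ suc))

  module _ {n : ℕ} where

    count : {P : Fin n → Set} → Decidable P → ℕ
    count P? = sum (λ i → 𝟙 (P? i))

    count-mono : {P Q : Fin n → Set} (P? : Decidable P) (Q? : Decidable Q) →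
                 (∀ {i} → P i → Q i) → count P? ≤ count Q?
    count-mono P? Q? f = sum-mono (λ i → 𝟙-mono (P? i) (Q? i) f)

    count-cong : {P Q : Fin n → Set} (P? : Decidable P) (Q? : Decidable Q) →
                 (∀ {i} → P i → Q i) → (∀ {i} → Q i → P i) → count P? ≡ count Q?
    count-cong P? Q? f g = ≤-antisym (count-mono P? Q? f) (count-mono Q? P? g)

    count-none : {P : Fin n → Set} (P? : Decidable P) → (∀ i → ¬ P i) → count P? ≡ 0
    count-none P? none = trans (sum-cong-≗ (λ i → 𝟙-no (P? i) (none i))) (sum-replicate-zero n)

    count-split : {P Q : Fin n → Set} (P? : Decidable P) (Q? : Decidable Q) →
                  count P? ≡ count (λ i → P? i ×-dec Q? i) + count (λ i → P? i ×-dec ¬? (Q? i))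
    count-split P? Q? =
      trans (sum-cong-≗ pointwise) (∑-distrib-+ (λ i → 𝟙 (P? i ×-dec Q? i)) (λ i → 𝟙 (P? i ×-dec ¬? (Q? i))))
      where
      pointwise : ∀ i → 𝟙 (P? i) ≡ 𝟙 (P? i ×-dec Q? i) + 𝟙 (P? i ×-dec ¬? (Q? i))
      pointwise i with P? i | Q? i
      ... | yes _ | yes _ = refl
      ... | yes _ | no _  = refl
      ... | no _  | _     = refl

  ∣p∣≡count : ∀ {n} (p : Subset n) → ∣ p ∣ ≡ count (_∈? p)
  ∣p∣≡count []            = refl
  ∣p∣≡count (inside ∷ p)  =
    cong suc (trans (∣p∣≡count p) (count-cong (_∈? p) (λ i → suc i ∈? inside ∷ p) there drop-there))
  ∣p∣≡count (outside ∷ p) =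
    trans (∣p∣≡count p) (count-cong (_∈? p) (λ i → suc i ∈? outside ∷ p) there drop-there)

  module _ {n : ℕ} where

    count-remove : {P : Fin n → Set} (P? : Decidable P) {i₀ : Fin n} → P i₀ →
                   count P? ≡ suc (count (λ i → P? i ×-dec ¬? (i ≟ i₀)))
    count-remove {P} P? {i₀} Pi₀ = begin
      count P?                                ≡⟨ count-split P? (_≟ i₀) ⟩
      count at-i₀ + count (λ i → P? i ×-dec ¬? (i ≟ i₀))
        ≡⟨ cong (_+ count (λ i → P? i ×-dec ¬? (i ≟ i₀))) only-i₀ ⟩
      suc (count (λ i → P? i ×-dec ¬? (i ≟ i₀)))  ∎
      where
      open ≡-Reasoning
      at-i₀ : Decidable (λ i → P i × i ≡ i₀)
      at-i₀ i = P? i ×-dec (i ≟ i₀)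
      only-i₀ : count at-i₀ ≡ 1
      only-i₀ = begin
        count at-i₀         ≡⟨ count-cong at-i₀ (_∈? ⁅ i₀ ⁆) (λ { (_ , refl) → x∈⁅x⁆ i₀ })
                                                             (λ i∈ → subst P (sym (x∈⁅y⁆⇒x≡y i₀ i∈)) Pi₀ , x∈⁅y⁆⇒x≡y i₀ i∈) ⟩
        count (_∈? ⁅ i₀ ⁆)  ≡⟨ sym (∣p∣≡count ⁅ i₀ ⁆) ⟩
        ∣ ⁅ i₀ ⁆ ∣          ≡⟨ ∣⁅x⁆∣≡1 i₀ ⟩
        1                   ∎

    count-≥1 : {P : Fin n → Set} (P? : Decidable P) {i : Fin n} → P i → 1 ≤ count P?
    count-≥1 P? Pi = subst (1 ≤_) (sym (count-remove P? Pi)) (s≤s z≤n)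

    count≥2 : {P : Fin n → Set} (P? : Decidable P) → ∀ {i j} → i ≢ j → P i → P j → 2 ≤ count P?
    count≥2 P? i≢j Pi Pj = subst (2 ≤_) (sym (count-remove P? Pi))
                                  (s≤s (count-≥1 (λ l → P? l ×-dec ¬? (l ≟ _)) (Pj , i≢j ∘ sym)))

    count≤1⇒unique : {P : Fin n → Set} (P? : Decidable P) → count P? ≤ 1 →
                     ∀ {i j} → P i → P j → i ≡ j
    count≤1⇒unique P? count≤1 {i} {j} Pi Pj with i ≟ j
    ... | yes i≡j = i≡j
    ... | no  i≢j = contradiction (≤-trans (count≥2 P? i≢j Pi Pj) count≤1) λ { (s≤s ()) }

    count-gap : {P Q : Fin n → Set} (P? : Decidable P) (Q? : Decidable Q) →
                count P? < count Q? → ∃ λ i → Q i × ¬ P i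
    count-gap {P} {Q} P? Q? P<Q with any? (λ i → Q? i ×-dec ¬? (P? i))
    ... | yes witness = witness
    ... | no  none    = contradiction (count-mono Q? P? Q⇒P) (<⇒≱ P<Q)
      where
      Q⇒P : ∀ {i} → Q i → P i
      Q⇒P {i} Qi with P? i
      ... | yes Pi = Pi
      ... | no ¬Pi = contradiction (i , Qi , ¬Pi) none

    count-witness : {P : Fin n → Set} (P? : Decidable P) → 0 < count P? → ∃ P
    count-witness P? 0<count =
      let (i , Pi , _) = count-gap none? P? (subst (_< count P?) (sym (count-none none? (λ _ ()))) 0<count)
      in i , Pi
      where
      none? : Decidable (λ (_ : Fin n) → ⊥)
      none? _ = no id

    count-strict : {P Q : Fin n → Set} (P? : Decidable P) (Q? : Decidable Q) →
                   (∀ {i} → P i → Q i) → ∀ {j} → Q j → ¬ P j → count P? < count Q?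
    count-strict P? Q? P⇒Q Qj ¬Pj = begin-strict
      count P?                       ≡⟨ count-cong P? (λ i → Q? i ×-dec P? i) (λ Pi → P⇒Q Pi , Pi) proj₂ ⟩
      count (λ i → Q? i ×-dec P? i)  <⟨ m<m+n _ (count-≥1 (λ i → Q? i ×-dec ¬? (P? i)) (Qj , ¬Pj)) ⟩
      count (λ i → Q? i ×-dec P? i) + count (λ i → Q? i ×-dec ¬? (P? i))  ≡⟨ count-split Q? P? ⟨
      count Q?                       ∎
      where open ≤-Reasoning

    count-if : {A : Set} {R : Fin n → Set} (A? : Dec A) (R? : Decidable R) {c : ℕ} →
               (A → count R? ≡ c) → (¬ A → ∀ i → ¬ R i) → count R? ≡ c * 𝟙 A?
    count-if (yes a) R? {c} sized _ = trans (sized a) (sym (*-identityʳ c))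
    count-if (no ¬a) R? {c} _ empty = trans (count-none R? (empty ¬a)) (sym (*-zeroʳ c))

    sum-weighted : {A : Fin n → Set} (A? : Decidable A) (c : ℕ) → sum (λ i → c * 𝟙 (A? i)) ≡ c * count A?
    sum-weighted A? c = sym (*-distribˡ-sum c (λ i → 𝟙 (A? i)))

  module _ {A : Set} {P : A → Set} (P? : Decidable P) where

    length-filter-∷ : ∀ x xs → length (filter P? (x ∷ xs)) ≡ 𝟙 (P? x) + length (filter P? xs)
    length-filter-∷ x xs with P? x
    ... | yes _ = refl
    ... | no _  = refl

    length-filter-tabulate : ∀ {n} (f : Fin n → A) → length (filter P? (tabulate f)) ≡ sum (λ i → 𝟙 (P? (f i)))
    length-filter-tabulate {zero}  f = refl
    length-filter-tabulate {suc n} f =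
      trans (length-filter-∷ (f zero) (tabulate (f ∘ suc))) (cong (𝟙 (P? (f zero)) +_) (length-filter-tabulate (f ∘ suc)))

  length-filter-allFin : ∀ {n} {P : Fin n → Set} (P? : Decidable P) → length (filter P? (allFin n)) ≡ count P?
  length-filter-allFin P? = length-filter-tabulate P? id

  inj-count : ∀ {A : Set} {n} {Q : Fin n → Set} (Q? : Decidable Q) (R : A → Fin n → Set) →
              (xs : List A) → Unique xs →
              (∀ {a} → a ∈ˡ xs → ∃ λ i → Q i × R a i) →
              (∀ {a a′ i} → a ∈ˡ xs → a′ ∈ˡ xs → R a i → R a′ i → a ≡ a′) →
              length xs ≤ count Q?
  inj-count Q? R []       _               _     _   = z≤n
  inj-count {Q = Q} Q? R (a ∷ xs) (a∉xs ∷ unique) image inj =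
    let (i₀ , Qi₀ , Rai₀) = image (hereˡ refl) in
    subst (length (a ∷ xs) ≤_) (sym (count-remove Q? Qi₀))
          (s≤s (inj-count (λ i → Q? i ×-dec ¬? (i ≟ i₀)) R xs unique (image′ i₀ Rai₀)
                          (λ m m′ → inj (thereˡ m) (thereˡ m′))))
    where
    image′ : ∀ i₀ → R a i₀ → ∀ {a′} → a′ ∈ˡ xs → ∃ λ i → (Q i × i ≢ i₀) × R a′ i
    image′ i₀ Rai₀ m with image (thereˡ m)
    ... | i , Qi , Ra′i = i , (Qi , λ { refl → All.lookup a∉xs m (inj (hereˡ refl) (thereˡ m) Rai₀ Ra′i) }) , Ra′i

  incidence-bound : ∀ {A : Set} {n} (f : A → Subset n) (c : ℕ) (xs : List A) →
                    (∀ {a} → a ∈ˡ xs → c ≤ ∣ f a ∣) →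
                    length xs * c ≤ sum (λ i → length (filter (λ a → i ∈? f a) xs))
  incidence-bound f c []       _     = z≤n
  incidence-bound {A} {n} f c (a ∷ xs) large = begin
    c + length xs * c
      ≤⟨ +-mono-≤ (large (hereˡ refl)) (incidence-bound f c xs (large ∘ thereˡ)) ⟩
    ∣ f a ∣ + sum (λ i → incidences i xs)
      ≡⟨ cong (_+ sum (λ i → incidences i xs)) (∣p∣≡count (f a)) ⟩
    count (_∈? f a) + sum (λ i → incidences i xs)
      ≡⟨ ∑-distrib-+ (λ i → 𝟙 (i ∈? f a)) (λ i → incidences i xs) ⟨
    sum (λ i → 𝟙 (i ∈? f a) + incidences i xs)
      ≡⟨ sum-cong-≗ (λ i → length-filter-∷ (λ a → i ∈? f a) a xs) ⟨
    sum (λ i → incidences i (a ∷ xs))  ∎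
    where
    open ≤-Reasoning
    incidences : Fin n → List A → ℕ
    incidences i ys = length (filter (λ a → i ∈? f a) ys)

  count-injection : ∀ {m n} {P : Fin m → Set} {Q : Fin n → Set} (P? : Decidable P) (Q? : Decidable Q)
                    (R : Fin m → Fin n → Set) →
                    (∀ {i} → P i → ∃ λ j → Q j × R i j) →
                    (∀ {i i′ j} → P i → P i′ → R i j → R i′ j → i ≡ i′) →
                    count P? ≤ count Q?
  count-injection {m} {P = P} P? Q? R image inj =
    subst (_≤ count Q?) (length-filter-allFin {n = m} P?)
          (inj-count Q? R (filter P? (allFin m)) (filter⁺ P? (allFin⁺ m))
                     (image ∘ instance-of) (λ i∈ i′∈ → inj (instance-of i∈) (instance-of i′∈)))
    where
    instance-of : ∀ {i} → i ∈ˡ filter P? (allFin m) → P i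
    instance-of i∈ = proj₂ (∈-filter⁻ P? {xs = allFin m} i∈)

  distinct-pair : ∀ {A : Set} {xs : List A} → Unique xs → 1 < length xs →
                  ∃ λ a → ∃ λ a′ → a ∈ˡ xs × a′ ∈ˡ xs × a ≢ a′
  distinct-pair {xs = a ∷ []}     _        (s≤s ())
  distinct-pair {xs = a ∷ a′ ∷ _} (a≢ ∷ _) _ = a , a′ , hereˡ refl , thereˡ (hereˡ refl) , All.head a≢

  sum-const : ∀ {n} (c : ℕ) → sum {n} (λ _ → c) ≡ n * c
  sum-const {zero}  c = refl
  sum-const {suc n} c = cong (c +_) (sum-const {n} c)

module SubsetSize where

  open Counting
  open import Data.Nat.Properties using (<⇒≱)
  open import Data.Fin using (zero; suc)
  open import Data.Fin.Subset using (_⊆_; ⊥; inside; outside; ⁅_⁆; _∪_; _-_)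
  open import Data.Fin.Subset.Properties
    using (∣⊥∣≡0; ∣⁅x⁆∣≡1; x∉⁅y⁆⇒x≢y; ⊆-antisym; p⊂q⇒∣p∣<∣q∣; ∪-identityʳ; p─⊥≡p;
           x∈p∪q⁻; x∈⁅y⁆⇒x≡y)
  open import Data.Vec using (_∷_; _[_]=_)
  open _[_]=_ using (here; there)
  open import Data.Sum using (inj₁; inj₂)
  open import Relation.Binary.PropositionalEquality using (cong; subst₂)

  point-outside : ∀ {n} {p q : Subset n} → ∣ p ∣ < ∣ q ∣ → ∃ λ x → x ∈ q × x ∉ p
  point-outside {p = p} {q} ∣p∣<∣q∣ =
    count-gap (_∈? p) (_∈? q) (subst₂ _<_ (∣p∣≡count p) (∣p∣≡count q) ∣p∣<∣q∣)

  some-member : ∀ {n} {p : Subset n} → 0 < ∣ p ∣ → ∃ λ x → x ∈ p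
  some-member {n} {p} 0<∣p∣ =
    let (x , x∈p , _) = point-outside {p = ⊥} (subst (_< ∣ p ∣) (sym (∣⊥∣≡0 n)) 0<∣p∣) in x , x∈p

  another-member : ∀ {n} {p : Subset n} → 1 < ∣ p ∣ → ∀ x → ∃ λ y → y ∈ p × y ≢ x
  another-member {p = p} 1<∣p∣ x =
    let (y , y∈p , y∉⁅x⁆) = point-outside {p = ⁅ x ⁆} (subst (_< ∣ p ∣) (sym (∣⁅x⁆∣≡1 x)) 1<∣p∣)
    in y , y∈p , x∉⁅y⁆⇒x≢y y∉⁅x⁆

  ⊆-size-eq : ∀ {n} {p q : Subset n} → p ⊆ q → ∣ q ∣ ≤ ∣ p ∣ → p ≡ q
  ⊆-size-eq {p = p} {q} p⊆q ∣q∣≤∣p∣ = ⊆-antisym p⊆q q⊆p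
    where
    q⊆p : q ⊆ p
    q⊆p {x} x∈q with x ∈? p
    ... | yes x∈p = x∈p
    ... | no  x∉p = contradiction ∣q∣≤∣p∣ (<⇒≱ (p⊂q⇒∣p∣<∣q∣ (p⊆q , x , x∈q , x∉p)))

  ∣p∪⁅x⁆∣ : ∀ {n} {p : Subset n} {x} → x ∉ p → ∣ p ∪ ⁅ x ⁆ ∣ ≡ suc ∣ p ∣
  ∣p∪⁅x⁆∣ {p = inside  ∷ p} {zero}  x∉p = contradiction here x∉p
  ∣p∪⁅x⁆∣ {p = outside ∷ p} {zero}  _   = cong (λ q → suc ∣ q ∣) (∪-identityʳ p)
  ∣p∪⁅x⁆∣ {p = inside  ∷ p} {suc x} x∉p = cong suc (∣p∪⁅x⁆∣ (x∉p ∘ there))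
  ∣p∪⁅x⁆∣ {p = outside ∷ p} {suc x} x∉p = ∣p∪⁅x⁆∣ (x∉p ∘ there)

  ∣p-x∣ : ∀ {n} {p : Subset n} {x} → x ∈ p → suc ∣ p - x ∣ ≡ ∣ p ∣
  ∣p-x∣ {p = inside  ∷ p} here          = cong (λ q → suc ∣ q ∣) (p─⊥≡p p)
  ∣p-x∣ {p = inside  ∷ p} (there x∈p)   = cong suc (∣p-x∣ x∈p)
  ∣p-x∣ {p = outside ∷ p} (there x∈p)   = ∣p-x∣ x∈p

  two-members : ∀ {n} {p : Subset n} {x y} → x ≢ y → x ∈ p → y ∈ p → 2 ≤ ∣ p ∣
  two-members {p = p} x≢y x∈p y∈p = subst (2 ≤_) (sym (∣p∣≡count p)) (count≥2 (_∈? p) x≢y x∈p y∈p)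

  pick-two : ∀ {n} {p : Subset n} → 1 < ∣ p ∣ → ∃ λ x → ∃ λ y → x ≢ y × x ∈ p × y ∈ p
  pick-two 1<∣p∣ =
    let (x , x∈p) = some-member (<-trans (s≤s z≤n) 1<∣p∣)
        (y , y∈p , y≢x) = another-member 1<∣p∣ x
    in x , y , y≢x ∘ sym , x∈p , y∈p

  p∪⁅y⁆⊆ : ∀ {n} {p q : Subset n} {y} → p ⊆ q → y ∈ q → p ∪ ⁅ y ⁆ ⊆ q
  p∪⁅y⁆⊆ {p = p} {q} {y} p⊆q y∈q z∈ with x∈p∪q⁻ p ⁅ y ⁆ z∈
  ... | inj₁ z∈p   = p⊆q z∈p
  ... | inj₂ z∈⁅y⁆ = subst (_∈ q) (sym (x∈⁅y⁆⇒x≡y y z∈⁅y⁆)) y∈q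

  member⇒0<∣p∣ : ∀ {n} {p : Subset n} {x} → x ∈ p → 0 < ∣ p ∣
  member⇒0<∣p∣ {p = p} x∈p = subst (1 ≤_) (sym (∣p∣≡count p)) (count-≥1 (_∈? p) x∈p)

module Blocks {v b : ℕ} (blocks : Vec (Subset v) b) where

  open Counting
  open SubsetSize
  open import Data.Nat.Properties
    using (≤-reflexive; ≤-antisym; <-≤-trans; ≮⇒≥; +-comm; *-identityˡ; *-identityʳ; *-zeroʳ;
           *-distribʳ-∸; *-cancelˡ-<)
  open import Algebra.Properties.Semiring.Sum +-*-semiring using (∑-comm)
  open import Data.Nat using (s<s⁻¹)
  open import Data.Fin using (_≟_)
  open import Data.Fin.Properties using (toℕ<n)
  open import Data.Fin.Subset using (_⊆_; ⊤; _-_; ⁅_⁆; _∪_)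
  open import Data.Fin.Subset.Properties
    using (∈⊤; ⊆-antisym; p∩q⊆p; p∩q⊆q; p─q⊆p; p⊆p∪q; q⊆p∪q; x∈⁅x⁆; p⊆q⇒∣p∣≤∣q∣)
  open import Data.Vec using (lookup)
  open import Relation.Binary.PropositionalEquality using (cong; cong₂; module ≡-Reasoning)

  blk : Fin b → Subset v
  blk = lookup blocks

  joins? : (B : Subset b) (x y : Fin v) → Decidable (λ i → i ∈ B × x ∈ blk i × y ∈ blk i)
  joins? B x y i = (i ∈? B) ×-dec ((x ∈? blk i) ×-dec (y ∈? blk i))

  through? : (B : Subset b) (x : Fin v) → Decidable (λ i → i ∈ B × x ∈ blk i)
  through? B x i = (i ∈? B) ×-dec (x ∈? blk i)

  -- A (|V|, k, 1)-BIBD on V with blocks B, that is, a linear space whose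
  -- lines all have k points.
  module Linear {V : Subset v} {B : Subset b} {k : ℕ} (design : IsBIBDOn blocks V B k 1) where

    1<k : 1 < k
    1<k = proj₁ design

    line⊆V : ∀ {i} → i ∈ B → blk i ⊆ V
    line⊆V i∈B = proj₁ (proj₂ design) _ i∈B

    ∣line∣ : ∀ {i} → i ∈ B → ∣ blk i ∣ ≡ k
    ∣line∣ i∈B = proj₁ (proj₂ (proj₂ design)) _ i∈B

    non-line : ∃ λ S → S ⊆ V × ∣ S ∣ ≡ k × (∀ i → i ∈ B → blk i ≢ S)
    non-line = proj₂ (proj₂ (proj₂ (proj₂ design)))

    one-line : ∀ {x y} → x ∈ V → y ∈ V → x ≢ y → count (joins? B x y) ≡ 1
    one-line {x} {y} x∈V y∈V x≢y =
      trans (sym (length-filter-allFin (joins? B x y))) (proj₁ (proj₂ (proj₂ (proj₂ design))) x y x∈V y∈V x≢y)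

    line : ∀ {x y} → x ∈ V → y ∈ V → x ≢ y → ∃ λ i → i ∈ B × x ∈ blk i × y ∈ blk i
    line x∈V y∈V x≢y = count-witness (joins? B _ _) (subst (0 <_) (sym (one-line x∈V y∈V x≢y)) (s≤s z≤n))

    line-unique : ∀ {x y i j} → x ≢ y → i ∈ B → x ∈ blk i → y ∈ blk i →
                  j ∈ B → x ∈ blk j → y ∈ blk j → i ≡ j
    line-unique x≢y i∈B x∈i y∈i j∈B x∈j y∈j =
      count≤1⇒unique (joins? B _ _) (≤-reflexive (one-line (line⊆V i∈B x∈i) (line⊆V i∈B y∈i) x≢y))
                     (i∈B , x∈i , y∈i) (j∈B , x∈j , y∈j)

    -- Blocks of size 2 would make every 2-subset a block, a trivial design.
    2<k : 2 < k
    2<k = ≤∧≢⇒< 1<k k≢2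
      where
      k≢2 : 2 ≢ k
      k≢2 refl =
        let (S , S⊆V , ∣S∣≡2 , S-not-line) = non-line
            (x , y , x≢y , x∈S , y∈S) = pick-two (subst (1 <_) (sym ∣S∣≡2) 1<k)
            (i , i∈B , x∈i , y∈i) = line (S⊆V x∈S) (S⊆V y∈S) x≢y
            2≤∣S∩i∣ = two-members x≢y (x∈p∩q⁺ (x∈S , x∈i)) (x∈p∩q⁺ (y∈S , y∈i))
            S∩i≡S = ⊆-size-eq (p∩q⊆p S (blk i)) (≤-trans (≤-reflexive ∣S∣≡2) 2≤∣S∩i∣)
            S∩i≡i = ⊆-size-eq (p∩q⊆q S (blk i)) (≤-trans (≤-reflexive (∣line∣ i∈B)) 2≤∣S∩i∣)
        in S-not-line i i∈B (trans (sym S∩i≡i) S∩i≡S)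

    r : Fin v → ℕ
    r x = count (through? B x)

    -- Counting the pairs (y, line through x and y) in two ways:
    -- every other point y of V lies on exactly one line through x, and
    -- every line through x carries k - 1 other points.
    replication : ∀ {x} → x ∈ V → suc ((k ∸ 1) * r x) ≡ ∣ V ∣
    replication {x} x∈V = begin
      suc ((k ∸ 1) * r x)                                ≡⟨ cong suc (sum-weighted (through? B x) (k ∸ 1)) ⟨
      suc (sum (λ i → (k ∸ 1) * 𝟙 (through? B x i)))      ≡⟨ cong suc (sum-cong-≗ per-line) ⟨
      suc (sum (λ i → count (λ y → flag? y i)))           ≡⟨ cong suc (∑-comm (λ y i → 𝟙 (flag? y i))) ⟨
      suc (sum (λ y → count (flag? y)))                   ≡⟨ cong suc (sum-cong-≗ per-point) ⟩
      suc (sum (λ y → 1 * 𝟙 (other? y)))                  ≡⟨ cong suc (sum-weighted other? 1) ⟩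
      suc (1 * count other?)                              ≡⟨ cong suc (*-identityˡ (count other?)) ⟩
      suc (count other?)                                  ≡⟨ count-remove (_∈? V) x∈V ⟨
      count (_∈? V)                                       ≡⟨ ∣p∣≡count V ⟨
      ∣ V ∣                                               ∎
      where
      open ≡-Reasoning
      flag? : (y : Fin v) → Decidable (λ i → (i ∈ B × x ∈ blk i) × (y ∈ blk i × y ≢ x))
      flag? y i = through? B x i ×-dec ((y ∈? blk i) ×-dec ¬? (y ≟ x))
      other? : Decidable (λ y → y ∈ V × y ≢ x)
      other? y = (y ∈? V) ×-dec ¬? (y ≟ x)
      per-point : ∀ y → count (flag? y) ≡ 1 * 𝟙 (other? y)
      per-point y = count-if (other? y) (flag? y)
        (λ (y∈V , y≢x) → trans (count-cong (flag? y) (joins? B x y)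
                                  (λ ((i∈B , x∈i) , y∈i , _) → i∈B , x∈i , y∈i)
                                  (λ (i∈B , x∈i , y∈i) → (i∈B , x∈i) , y∈i , y≢x))
                                (one-line x∈V y∈V (y≢x ∘ sym)))
        (λ not-other i ((i∈B , _) , y∈i , y≢x) → not-other (line⊆V i∈B y∈i , y≢x))
      per-line : ∀ i → count (λ y → flag? y i) ≡ (k ∸ 1) * 𝟙 (through? B x i)
      per-line i = count-if (through? B x i) (λ y → flag? y i)
        (λ (i∈B , x∈i) → begin
          count (λ y → flag? y i)                         ≡⟨ count-cong (λ y → flag? y i) others-on-i proj₂ (λ o → (i∈B , x∈i) , o) ⟩
          count others-on-i                               ≡⟨ cong (_∸ 1) (count-remove (_∈? blk i) x∈i) ⟨
          count (_∈? blk i) ∸ 1                           ≡⟨ cong (_∸ 1) (trans (sym (∣line∣ i∈B)) (∣p∣≡count (blk i))) ⟨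
          k ∸ 1                                           ∎)
        (λ not-through y (through , _) → not-through through)
        where
        others-on-i : Decidable (λ y → y ∈ blk i × y ≢ x)
        others-on-i y = (y ∈? blk i) ×-dec ¬? (y ≟ x)

    many-lines : ∀ {x} → x ∈ V → k * k ∸ k + 1 < ∣ V ∣ → k < r x
    many-lines {x} x∈V large = *-cancelˡ-< (k ∸ 1) k (r x) (s<s⁻¹ (begin-strict
      suc ((k ∸ 1) * k)      ≡⟨ cong suc (trans (*-distribʳ-∸ k k 1) (cong (k * k ∸_) (*-identityˡ k))) ⟩
      suc (k * k ∸ k)        ≡⟨ +-comm 1 (k * k ∸ k) ⟩
      k * k ∸ k + 1          <⟨ large ⟩
      ∣ V ∣                  ≡⟨ replication x∈V ⟨
      suc ((k ∸ 1) * r x)    ∎))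
      where open ≤-Reasoning

    fisher-bound : k * k ∸ k + 1 < ∣ V ∣ → ∣ V ∣ < ∣ B ∣
    fisher-bound large = *-cancelˡ-< k ∣ V ∣ ∣ B ∣ (begin-strict
      k * ∣ V ∣                                 <⟨ m<n+m (k * ∣ V ∣) (<-≤-trans (s≤s z≤n) large) ⟩
      ∣ V ∣ + k * ∣ V ∣                          ≡⟨ cong (suc k *_) (∣p∣≡count V) ⟩
      suc k * count (_∈? V)                     ≡⟨ sum-weighted (_∈? V) (suc k) ⟨
      sum (λ x → suc k * 𝟙 (x ∈? V))            ≤⟨ sum-mono lower ⟩
      sum (λ x → r x)                           ≡⟨ ∑-comm (λ x i → 𝟙 (through? B x i)) ⟩
      sum (λ i → count (λ x → through? B x i))  ≡⟨ sum-cong-≗ per-line ⟩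
      sum (λ i → k * 𝟙 (i ∈? B))                ≡⟨ sum-weighted (_∈? B) k ⟩
      k * count (_∈? B)                         ≡⟨ cong (k *_) (∣p∣≡count B) ⟨
      k * ∣ B ∣                                 ∎)
      where
      open ≤-Reasoning
      lower : ∀ x → suc k * 𝟙 (x ∈? V) ≤ r x
      lower x with x ∈? V
      ... | yes x∈V = subst (_≤ r x) (sym (*-identityʳ (suc k))) (many-lines x∈V large)
      ... | no  _   = subst (_≤ r x) (sym (*-zeroʳ k)) z≤n
      per-line : ∀ i → count (λ x → through? B x i) ≡ k * 𝟙 (i ∈? B)
      per-line i = count-if (i ∈? B) (λ x → through? B x i)
        (λ i∈B → trans (count-cong (λ x → through? B x i) (_∈? blk i) proj₂ (i∈B ,_))
                        (trans (sym (∣p∣≡count (blk i))) (∣line∣ i∈B)))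
        (λ i∉B x (i∈B , _) → i∉B i∈B)

    fewer-lines-through : k < ∣ V ∣ → ∀ {x} → x ∈ V → r x < ∣ B ∣
    fewer-lines-through large {x} x∈V =
      let (x′ , x′∈V , x′≢x) = another-member (<-trans 1<k large) x
          (d , d∈B , x∈d , _) = line x∈V x′∈V (x′≢x ∘ sym)
          (z , z∈V , z∉d) = point-outside (subst (_< ∣ V ∣) (sym (∣line∣ d∈B)) large)
          (w , w∈d , w≢x) = another-member (subst (1 <_) (sym (∣line∣ d∈B)) 1<k) x
          (j , j∈B , w∈j , z∈j) = line (line⊆V d∈B w∈d) z∈V (λ w≡z → z∉d (subst (_∈ blk d) w≡z w∈d))
          x∉j : x ∉ blk j
          x∉j x∈j = z∉d (subst (λ l → z ∈ blk l) (line-unique (w≢x ∘ sym) j∈B x∈j w∈j d∈B x∈d w∈d) z∈j)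
      in subst (r x <_) (sym (∣p∣≡count B)) (count-strict (through? B x) (_∈? B) proj₁ j∈B (x∉j ∘ proj₂))

  module Ambient {k : ℕ} (bibd : IsBIBD blocks k) where

    private
      module A = Linear (proj₂ bibd)

    open A public using (1<k; 2<k)

    ∣blk∣ : ∀ i → ∣ blk i ∣ ≡ k
    ∣blk∣ i = A.∣line∣ ∈⊤

    block : ∀ {x y} → x ≢ y → ∃ λ i → x ∈ blk i × y ∈ blk i
    block x≢y = let (i , _ , x∈i , y∈i) = A.line ∈⊤ ∈⊤ x≢y in i , x∈i , y∈i

    block-unique : ∀ {x y i j} → x ≢ y → x ∈ blk i → y ∈ blk i → x ∈ blk j → y ∈ blk j → i ≡ j
    block-unique x≢y x∈i y∈i x∈j y∈j = A.line-unique x≢y ∈⊤ x∈i y∈i ∈⊤ x∈j y∈j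

    one-joining-block : ∀ {B x y i} → x ≢ y → i ∈ B → x ∈ blk i → y ∈ blk i → count (joins? B x y) ≡ 1
    one-joining-block {B} {x} {y} x≢y i∈B x∈i y∈i = ≤-antisym
      (subst (count (joins? B x y) ≤_) (A.one-line ∈⊤ ∈⊤ x≢y)
             (count-mono (joins? B x y) (joins? ⊤ x y) (λ (_ , on-i) → ∈⊤ , on-i)))
      (count-≥1 (joins? B x y) (i∈B , x∈i , y∈i))

    module Sub (s : SubDesign v b) (sub : IsSubBIBD blocks k s) where

      open Linear sub public hiding (1<k; 2<k)

      joining-block-in : ∀ {x y i} → x ≢ y → x ∈ blk i → y ∈ blk i →
                         x ∈ points s → y ∈ points s → i ∈ blockIdx s
      joining-block-in x≢y x∈i y∈i x∈s y∈s =
        let (j , j∈s , x∈j , y∈j) = line x∈s y∈s x≢y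
        in subst (_∈ blockIdx s) (block-unique x≢y x∈j y∈j x∈i y∈i) j∈s

      block-closed : ∀ {i} → blk i ⊆ points s → i ∈ blockIdx s
      block-closed {i} i⊆s =
        let (x , y , x≢y , x∈i , y∈i) = pick-two (subst (1 <_) (sym (∣blk∣ i)) 1<k)
        in joining-block-in x≢y x∈i y∈i (i⊆s x∈i) (i⊆s y∈i)

    same-points : ∀ {s t} → IsSubBIBD blocks k s → IsSubBIBD blocks k t → points s ≡ points t → s ≡ t
    same-points {s} {t} sub-s sub-t s≡t =
      cong₂ _,_ s≡t (⊆-antisym (moves s≡t sub-s sub-t) (moves (sym s≡t) sub-t sub-s))
      where
      moves : ∀ {s t} → points s ≡ points t → IsSubBIBD blocks k s → IsSubBIBD blocks k t →
              blockIdx s ⊆ blockIdx t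
      moves s≡t sub-s sub-t i∈s = Sub.block-closed _ sub-t (subst (_ ⊆_) s≡t (Sub.line⊆V _ sub-s i∈s))

    swap : Fin b → Fin v → Fin v → Subset v
    swap C c y = (blk C - c) ∪ ⁅ y ⁆

    ∣swap∣ : ∀ {C c y} → c ∈ blk C → y ∉ blk C → ∣ swap C c y ∣ ≡ k
    ∣swap∣ {C} {c} c∈C y∉C =
      trans (∣p∪⁅x⁆∣ (y∉C ∘ p─q⊆p (blk C) ⁅ c ⁆)) (trans (∣p-x∣ c∈C) (∣blk∣ C))

    -- The swapped set is no block: it keeps two points of C (as k > 2), so a
    -- block equal to it would be C, which misses y.
    swap-not-block : ∀ {C c y} → c ∈ blk C → y ∉ blk C → ∀ i → blk i ≢ swap C c y
    swap-not-block {C} {c} {y} c∈C y∉C i i≡swap =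
      let (a , a′ , a≢a′ , a∈ , a′∈) = pick-two {p = blk C - c}
                                          (s<s⁻¹ (subst (2 <_) (sym (trans (∣p-x∣ c∈C) (∣blk∣ C))) 2<k))
          i≡C = block-unique a≢a′ (on-i a∈) (on-i a′∈) (p─q⊆p (blk C) ⁅ c ⁆ a∈) (p─q⊆p (blk C) ⁅ c ⁆ a′∈)
      in y∉C (subst (λ l → y ∈ blk l) i≡C (subst (y ∈_) (sym i≡swap) (q⊆p∪q (blk C - c) ⁅ y ⁆ (x∈⁅x⁆ y))))
      where
      on-i : ∀ {z} → z ∈ blk C - c → z ∈ blk i
      on-i z∈ = subst (_ ∈_) (sym i≡swap) (p⊆p∪q ⁅ y ⁆ z∈)

    swap⊆ : ∀ {C c y P} → blk C ⊆ P → y ∈ P → swap C c y ⊆ P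
    swap⊆ {C} {c} C⊆P y∈P = p∪⁅y⁆⊆ (C⊆P ∘ p─q⊆p (blk C) ⁅ c ⁆) y∈P

    meet : SubDesign v b → SubDesign v b → SubDesign v b
    meet s t = points s ∩ points t , blockIdx s ∩ blockIdx t

    meet-subBIBD : ∀ {s t} → IsSubBIBD blocks k s → IsSubBIBD blocks k t →
                   ∀ {C y} → blk C ⊆ points (meet s t) → y ∈ points (meet s t) → y ∉ blk C →
                   IsSubBIBD blocks k (meet s t)
    meet-subBIBD {s} {t} sub-s sub-t {C} {y} C⊆ y∈ y∉C = 1<k , lines-in , (λ i _ → ∣blk∣ i) , pairs , non-block
      where
      module S = Sub s sub-s
      module T = Sub t sub-t
      lines-in : ∀ i → i ∈ blockIdx (meet s t) → blk i ⊆ points (meet s t)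
      lines-in i i∈ z∈i =
        let (i∈s , i∈t) = x∈p∩q⁻ _ _ i∈ in x∈p∩q⁺ (S.line⊆V i∈s z∈i , T.line⊆V i∈t z∈i)
      pairs : ∀ x z → x ∈ points (meet s t) → z ∈ points (meet s t) → x ≢ z →
              pairCount blocks (blockIdx (meet s t)) x z ≡ 1
      pairs x z x∈ z∈ x≢z =
        let (x∈s , x∈t) = x∈p∩q⁻ _ _ x∈
            (z∈s , z∈t) = x∈p∩q⁻ _ _ z∈
            (i , i∈s , x∈i , z∈i) = S.line x∈s z∈s x≢z
            i∈t = T.joining-block-in x≢z x∈i z∈i x∈t z∈t
        in trans (length-filter-allFin (joins? _ x z)) (one-joining-block x≢z (x∈p∩q⁺ (i∈s , i∈t)) x∈i z∈i)
      non-block : ∃ λ S′ → S′ ⊆ points (meet s t) × ∣ S′ ∣ ≡ k ×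
                            (∀ i → i ∈ blockIdx (meet s t) → blk i ≢ S′)
      non-block =
        let (c , c∈C) = some-member (subst (0 <_) (sym (∣blk∣ C)) (<-trans (s≤s z≤n) 1<k))
        in swap C c y , swap⊆ C⊆ y∈ , ∣swap∣ c∈C y∉C , (λ i _ → swap-not-block c∈C y∉C i)

    -- Two minimal sub-BIBDs sharing a block and a point off it coincide: their
    -- meet is a sub-BIBD with more than k points, so by minimality it is both.
    minimal-rigid : ∀ {s t} → IsMinimalSubBIBD blocks k s → IsMinimalSubBIBD blocks k t →
                    ∀ {C y} → blk C ⊆ points s → blk C ⊆ points t →
                    y ∈ points s → y ∈ points t → y ∉ blk C → s ≡ t
    minimal-rigid {s} {t} (sub-s , _ , min-s) (sub-t , _ , min-t) {C} {y} C⊆s C⊆t y∈s y∈t y∉C =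
      same-points sub-s sub-t (trans (sym meet≡s) meet≡t)
      where
      C⊆ : blk C ⊆ points (meet s t)
      C⊆ z∈C = x∈p∩q⁺ (C⊆s z∈C , C⊆t z∈C)
      y∈ : y ∈ points (meet s t)
      y∈ = x∈p∩q⁺ (y∈s , y∈t)
      sub-u : IsSubBIBD blocks k (meet s t)
      sub-u = meet-subBIBD sub-s sub-t C⊆ y∈ y∉C
      large : k < ∣ points (meet s t) ∣
      large = subst (_≤ ∣ points (meet s t) ∣) (trans (∣p∪⁅x⁆∣ y∉C) (cong suc (∣blk∣ C)))
                    (p⊆q⇒∣p∣≤∣q∣ (p∪⁅y⁆⊆ C⊆ y∈))
      meet≡s : points (meet s t) ≡ points s
      meet≡s = ⊆-size-eq (p∩q⊆p (points s) (points t)) (min-s (meet s t) sub-u large)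
      meet≡t : points (meet s t) ≡ points t
      meet≡t = ⊆-size-eq (p∩q⊆q (points s) (points t)) (min-t (meet s t) sub-u large)

    -- Distinct minimal sub-BIBDs share at most k points: otherwise the meet
    -- contains a block through two shared points and a shared point off it.
    small-meet : ∀ {s t} → IsMinimalSubBIBD blocks k s → IsMinimalSubBIBD blocks k t → s ≢ t →
                 ∣ points s ∩ points t ∣ ≤ k
    small-meet {s} {t} min-s@(sub-s , _) min-t@(sub-t , _) s≢t = ≮⇒≥ λ k<∣s∩t∣ →
      let (a , a′ , a≢a′ , a∈ , a′∈) = pick-two (<-trans 1<k k<∣s∩t∣)
          (a∈s , a∈t) = x∈p∩q⁻ (points s) (points t) a∈
          (a′∈s , a′∈t) = x∈p∩q⁻ (points s) (points t) a′∈
          (i , i∈s , a∈i , a′∈i) = Sub.line s sub-s a∈s a′∈s a≢a′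
          i∈t = Sub.joining-block-in t sub-t a≢a′ a∈i a′∈i a∈t a′∈t
          (y , y∈ , y∉i) = point-outside {p = blk i} (subst (_< ∣ points s ∩ points t ∣) (sym (∣blk∣ i)) k<∣s∩t∣)
          (y∈s , y∈t) = x∈p∩q⁻ (points s) (points t) y∈
      in s≢t (minimal-rigid min-s min-t (Sub.line⊆V s sub-s i∈s) (Sub.line⊆V t sub-t i∈t) y∈s y∈t y∉i)

    a-block : Fin b
    a-block =
      let (S , _ , ∣S∣≡k , _) = A.non-line
          (x , y , x≢y , _) = pick-two {p = S} (subst (1 <_) (sym ∣S∣≡k) 1<k)
      in proj₁ (block x≢y)

    0<b : 0 < b
    0<b = ≤-<-trans z≤n (toℕ<n a-block)

open Counting
open SubsetSize

fewer-than-blocks : ∀ {v b} (L : List (SubDesign v b)) (m : ℕ) → 0 < b →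
                    (∀ i → countBlock L i ≡ m) →
                    (∀ {S} → S ∈ˡ L → ∃ λ C → countBlock L C < ∣ blockIdx S ∣) →
                    length L < b
fewer-than-blocks {b = b} L m 0<b every-block-m rare-block = *-cancelʳ-< (suc m) (length L) b (begin-strict
  length L * suc m                   ≤⟨ incidence-bound blockIdx (suc m) L more-than-m ⟩
  sum (λ i → countBlock L i)         ≡⟨ sum-cong-≗ every-block-m ⟩
  sum {b} (λ _ → m)                  ≡⟨ sum-const {b} m ⟩
  b * m                              <⟨ m<n+m (b * m) 0<b ⟩
  b + b * m                          ≡⟨ *-suc b m ⟨
  b * suc m                          ∎)
  where
  open ≤-Reasoning
  more-than-m : ∀ {S} → S ∈ˡ L → suc m ≤ ∣ blockIdx S ∣
  more-than-m S∈L = let (C , fewer) = rare-block S∈L in subst (_< _) (every-block-m C) fewer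

module MinimalSubBIBDs {v b k : ℕ} (blocks : Vec (Subset v) b) (bibd : IsBIBD blocks k)
                       (L : List (SubDesign v b)) (enumerates : EnumeratesMinimal blocks k L) where

  open Blocks blocks
  open Ambient bibd

  minimal : ∀ {S} → S ∈ˡ L → IsMinimalSubBIBD blocks k S
  minimal {S} = Equivalence.to (proj₂ enumerates S)

  module M {S} (S∈L : S ∈ˡ L) = Sub S (proj₁ (minimal S∈L))

  containing-bound : ∀ {n} {Q : Fin n → Set} (Q? : Decidable Q) (R : SubDesign v b → Fin n → Set) (C : Fin b) →
                     (∀ {T} → T ∈ˡ L → C ∈ blockIdx T → ∃ λ j → Q j × R T j) →
                     (∀ {T T′ j} → T ∈ˡ L → T′ ∈ˡ L → C ∈ blockIdx T → C ∈ blockIdx T′ →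
                                   R T j → R T′ j → T ≡ T′) →
                     countBlock L C ≤ count Q?
  containing-bound Q? R C image inj =
    inj-count Q? R (filter (λ s → C ∈? blockIdx s) L) (filter⁺ (λ s → C ∈? blockIdx s) (proj₁ enumerates))
              (λ T∈ → let (T∈L , C∈T) = member T∈ in image T∈L C∈T)
              (λ T∈ T′∈ → let (T∈L , C∈T) = member T∈ ; (T′∈L , C∈T′) = member T′∈
                          in inj T∈L T′∈L C∈T C∈T′)
    where
    member : ∀ {T} → T ∈ˡ filter (λ s → C ∈? blockIdx s) L → T ∈ˡ L × C ∈ blockIdx T
    member = ∈-filter⁻ (λ s → C ∈? blockIdx s) {xs = L}

  -- For a
  -- point p of S ∈ L, some block lies in at most r_S(p) members of L, while
  -- r_S(p) < |B_S| because p misses some line of S.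
  module NoOnePointMeets (no-one-point : ∀ s t → s ∈ˡ L → t ∈ˡ L → s ≢ t → ∣ points s ∩ points t ∣ ≢ 1) where

    module _ {S} (S∈L : S ∈ˡ L) {p} (p∈S : p ∈ points S) where

      private module S = M S∈L

      -- For y outside S and the block C through p and y: each T ∋ C meets S in
      -- p and (by hypothesis) a further point q, so T contains the line of S
      -- through p and q; two such T sharing that line and y coincide.
      via-outside-point : ∀ {y C} → y ∉ points S → p ∈ blk C → y ∈ blk C → countBlock L C ≤ S.r p
      via-outside-point {y} {C} y∉S p∈C y∈C =
        containing-bound (through? (blockIdx S) p) (λ T i → i ∈ blockIdx S × i ∈ blockIdx T) C image inj
        where
        image : ∀ {T} → T ∈ˡ L → C ∈ blockIdx T →
                ∃ λ i → (i ∈ blockIdx S × p ∈ blk i) × (i ∈ blockIdx S × i ∈ blockIdx T)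
        image {T} T∈L C∈T =
          let module T = M T∈L
              p∈T = T.line⊆V C∈T p∈C
              S≢T : S ≢ T
              S≢T = λ { refl → y∉S (T.line⊆V C∈T y∈C) }
              1<∣S∩T∣ = ≤∧≢⇒< (member⇒0<∣p∣ (x∈p∩q⁺ (p∈S , p∈T))) (no-one-point S T S∈L T∈L S≢T ∘ sym)
              (q , q∈S∩T , q≢p) = another-member 1<∣S∩T∣ p
              (q∈S , q∈T) = x∈p∩q⁻ (points S) (points T) q∈S∩T
              (i , i∈S , p∈i , q∈i) = S.line p∈S q∈S (q≢p ∘ sym)
          in i , (i∈S , p∈i) , i∈S , T.joining-block-in (q≢p ∘ sym) p∈i q∈i p∈T q∈T
        inj : ∀ {T T′ i} → T ∈ˡ L → T′ ∈ˡ L → C ∈ blockIdx T → C ∈ blockIdx T′ →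
              i ∈ blockIdx S × i ∈ blockIdx T → i ∈ blockIdx S × i ∈ blockIdx T′ → T ≡ T′
        inj T∈L T′∈L C∈T C∈T′ (i∈S , i∈T) (_ , i∈T′) =
          minimal-rigid (minimal T∈L) (minimal T′∈L) (M.line⊆V T∈L i∈T) (M.line⊆V T′∈L i∈T′)
                        (M.line⊆V T∈L C∈T y∈C) (M.line⊆V T′∈L C∈T′ y∈C) (y∉S ∘ S.line⊆V i∈S)

      -- If S contains every point, each T ∈ L through a line D of S is S itself
      -- (T has a point off D, which lies in S).
      via-all-points : (∀ y → y ∈ points S) → ∀ {D} → D ∈ blockIdx S → p ∈ blk D → countBlock L D ≤ S.r p
      via-all-points everything {D} D∈S p∈D =
        containing-bound (through? (blockIdx S) p) (λ T _ → T ≡ S) D image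
                         (λ _ _ _ _ T≡S T′≡S → trans T≡S (sym T′≡S))
        where
        image : ∀ {T} → T ∈ˡ L → D ∈ blockIdx T → ∃ λ i → (i ∈ blockIdx S × p ∈ blk i) × T ≡ S
        image {T} T∈L D∈T =
          let T-large = proj₁ (proj₂ (minimal T∈L))
              (y , y∈T , y∉D) = point-outside (subst (_< ∣ points T ∣) (sym (∣blk∣ D)) T-large)
          in D , (D∈S , p∈D) , minimal-rigid (minimal T∈L) (minimal S∈L) (M.line⊆V T∈L D∈T) (S.line⊆V D∈S)
                                              y∈T (everything y) y∉D

    -- Some block of L lies in fewer members of L than S has blocks; which of
    -- the two constructions applies depends on whether S misses some point.
    rare-block : ∀ {S} → S ∈ˡ L → ∃ λ C → countBlock L C < ∣ blockIdx S ∣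
    rare-block {S} S∈L =
      let (p , p∈S) = some-member (≤-<-trans z≤n large)
          (C , C-bound) = rare p∈S
      in C , ≤-<-trans C-bound (M.fewer-lines-through S∈L large p∈S)
      where
      large : k < ∣ points S ∣
      large = proj₁ (proj₂ (minimal S∈L))
      rare : ∀ {p} → p ∈ points S → ∃ λ C → countBlock L C ≤ M.r S∈L p
      rare {p} p∈S with any? (λ y → ¬? (y ∈? points S))
      ... | yes (y , y∉S) =
        let (C , p∈C , y∈C) = block {p} {y} (λ p≡y → y∉S (subst (_∈ points S) p≡y p∈S))
        in C , via-outside-point S∈L p∈S y∉S p∈C y∈C
      ... | no none =
        let (q , q∈S , q≢p) = another-member (<-trans 1<k large) p
            (D , D∈S , p∈D , _) = M.line S∈L p∈S q∈S (q≢p ∘ sym)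
            everything y = decidable-stable (y ∈? points S) (λ y∉S → none (y , y∉S))
        in D , via-all-points S∈L p∈S everything D∈S p∈D

  module PairwiseMeeting {v′ : ℕ} (size : ∀ s → s ∈ˡ L → ∣ points s ∣ ≡ v′) (large : k * k ∸ k + 1 < v′)
                         (meets : ∀ s t → s ∈ˡ L → t ∈ˡ L → s ≢ t → ¬ Empty (points s ∩ points t)) where

    -- Distinct members of L have at most k < v' common points, so each has a
    -- point outside the other.
    point-outside-other : ∀ {S₁ S₂} → S₁ ∈ˡ L → S₂ ∈ˡ L → S₁ ≢ S₂ →
                          ∃ λ x → x ∈ points S₁ × x ∉ points S₂
    point-outside-other S₁∈L S₂∈L S₁≢S₂ =
      let (x , x∈S₁ , x∉S₁∩S₂) = point-outside (≤-<-trans (small-meet (minimal S₁∈L) (minimal S₂∈L) S₁≢S₂)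
                                                           (proj₁ (proj₂ (minimal S₁∈L))))
      in x , x∈S₁ , λ x∈S₂ → x∉S₁∩S₂ (x∈p∩q⁺ (x∈S₁ , x∈S₂))

    -- Lines of S₁ through x ∉ S₂ that meet S₂ inject into S₁ ∩ S₂, which has
    -- at most k < r(x) points; so some line of S₁ through x misses S₂.
    line-missing : ∀ {S₁ S₂ x} → S₁ ∈ˡ L → S₂ ∈ˡ L → S₁ ≢ S₂ → x ∈ points S₁ → x ∉ points S₂ →
                   ∃ λ M → (M ∈ blockIdx S₁ × x ∈ blk M) × ∀ {q} → q ∈ blk M → q ∉ points S₂
    line-missing {S₁} {S₂} {x} S₁∈L S₂∈L S₁≢S₂ x∈S₁ x∉S₂ =
      let (M , M-through , ¬meets) = count-gap through-meeting? (through? (blockIdx S₁) x) (≤-<-trans few-meeting r-large)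
      in M , M-through , λ q∈M q∈S₂ → ¬meets (M-through , _ , q∈M , q∈S₂)
      where
      module S₁ = M S₁∈L
      meets-S₂? : Decidable (λ i → ∃ λ q → q ∈ blk i × q ∈ points S₂)
      meets-S₂? i = any? (λ q → (q ∈? blk i) ×-dec (q ∈? points S₂))
      through-meeting? : Decidable (λ i → (i ∈ blockIdx S₁ × x ∈ blk i) × ∃ λ q → q ∈ blk i × q ∈ points S₂)
      through-meeting? i = through? (blockIdx S₁) x i ×-dec meets-S₂? i
      few-meeting : count through-meeting? ≤ k
      few-meeting = ≤-trans
        (count-injection through-meeting? (_∈? points S₁ ∩ points S₂) (λ i q → q ∈ blk i × q ∈ points S₂)
                         (λ ((i∈S₁ , _) , q , q∈i , q∈S₂) → q , x∈p∩q⁺ (S₁.line⊆V i∈S₁ q∈i , q∈S₂) , q∈i , q∈S₂)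
                         (λ ((_ , x∈i) , _) ((_ , x∈i′) , _) (q∈i , q∈S₂) (q∈i′ , _) →
                            block-unique (λ x≡q → x∉S₂ (subst (_∈ points S₂) (sym x≡q) q∈S₂)) x∈i q∈i x∈i′ q∈i′))
        (subst (_≤ k) (∣p∣≡count (points S₁ ∩ points S₂)) (small-meet (minimal S₁∈L) (minimal S₂∈L) S₁≢S₂))
      r-large : k < S₁.r x
      r-large = S₁.many-lines x∈S₁ (subst (k * k ∸ k + 1 <_) (sym (size S₁ S₁∈L)) large)

    -- A block M through a point x ∉ S₂ and missing S₂ lies in at most v'
    -- members of L: each T ∋ M meets S₂, and two of them sharing a point of S₂
    -- (off M) coincide.
    rarely-used-missing : ∀ {S₂ M x} → S₂ ∈ˡ L → x ∈ blk M → x ∉ points S₂ →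
                          (∀ {q} → q ∈ blk M → q ∉ points S₂) → countBlock L M ≤ v′
    rarely-used-missing {S₂} {M} {x} S₂∈L x∈M x∉S₂ M-misses-S₂ =
      subst (countBlock L M ≤_) (trans (sym (∣p∣≡count (points S₂))) (size S₂ S₂∈L))
            (containing-bound (_∈? points S₂) (λ T q → q ∈ points T × q ∈ points S₂) M image inj)
      where
      image : ∀ {T} → T ∈ˡ L → M ∈ blockIdx T → ∃ λ q → q ∈ points S₂ × (q ∈ points T × q ∈ points S₂)
      image {T} T∈L M∈T with nonempty? (points T ∩ points S₂)
      ... | yes (q , q∈) = let (q∈T , q∈S₂) = x∈p∩q⁻ (points T) (points S₂) q∈ in q , q∈S₂ , q∈T , q∈S₂
      ... | no  empty    = contradiction empty (meets T S₂ T∈L S₂∈L λ { refl → x∉S₂ (M.line⊆V T∈L M∈T x∈M) })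
      inj : ∀ {T T′ q} → T ∈ˡ L → T′ ∈ˡ L → M ∈ blockIdx T → M ∈ blockIdx T′ →
            q ∈ points T × q ∈ points S₂ → q ∈ points T′ × q ∈ points S₂ → T ≡ T′
      inj T∈L T′∈L M∈T M∈T′ (q∈T , q∈S₂) (q∈T′ , _) =
        minimal-rigid (minimal T∈L) (minimal T′∈L) (M.line⊆V T∈L M∈T) (M.line⊆V T′∈L M∈T′) q∈T q∈T′
                      (λ q∈M → M-misses-S₂ q∈M q∈S₂)

    avoiding-block : ∀ {S₁ S₂} → S₁ ∈ˡ L → S₂ ∈ˡ L → S₁ ≢ S₂ → ∃ λ M → countBlock L M ≤ v′
    avoiding-block S₁∈L S₂∈L S₁≢S₂ =
      let (x , x∈S₁ , x∉S₂) = point-outside-other S₁∈L S₂∈L S₁≢S₂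
          (M , (_ , x∈M) , M-misses-S₂) = line-missing S₁∈L S₂∈L S₁≢S₂ x∈S₁ x∉S₂
      in M , rarely-used-missing S₂∈L x∈M x∉S₂ M-misses-S₂

    rarely-used-block : ∃ λ C → countBlock L C ≤ v′
    rarely-used-block = by-length (length L ≤? 1)
      where
      few-members : ∀ C → length L ≤ 1 → countBlock L C ≤ v′
      few-members C L≤1 = ≤-trans (length-filter (λ s → C ∈? blockIdx s) L) (≤-trans L≤1 (≤-trans (s≤s z≤n) large))
      by-length : Dec (length L ≤ 1) → ∃ λ C → countBlock L C ≤ v′
      by-length (yes L≤1) = a-block , few-members a-block L≤1
      by-length (no L≰1) with distinct-pair (proj₁ enumerates) (≰⇒> L≰1)
      ... | S₁ , S₂ , S₁∈L , S₂∈L , S₁≢S₂ = avoiding-block S₁∈L S₂∈L S₁≢S₂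

    -- By the Fisher-type bound each member of L has more than v' blocks.
    rare-block : ∀ {S} → S ∈ˡ L → ∃ λ C → countBlock L C < ∣ blockIdx S ∣
    rare-block {S} S∈L =
      let (C , C-bound) = rarely-used-block
      in C , ≤-<-trans C-bound (subst (_< ∣ blockIdx S ∣) (size S S∈L)
                                  (M.fisher-bound S∈L (subst (k * k ∸ k + 1 <_) (sym (size S S∈L)) large)))

-- Both parts follow from the double-counting criterion; of well-distribution
-- only the constant number m of members through a block is needed.
proposition3p5 : ∀ {v b k v' : ℕ} (blocks : Vec (Subset v) b) → IsBIBD blocks k
    → (L : List (SubDesign v b)) → EnumeratesMinimal blocks k L → WellDistributed L
    → (∀ s → s ∈ˡ L → ∣ points s ∣ ≡ v')
    → ((∀ s t → s ∈ˡ L → t ∈ˡ L → s ≢ t → ∣ points s ∩ points t ∣ ≢ 1) → length L < b)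
    × (k * k ∸ k + 1 < v' → (∀ s t → s ∈ˡ L → t ∈ˡ L → s ≢ t → ¬ Empty (points s ∩ points t)) → length L < b)
proposition3p5 blocks bibd L enumerates (_ , m , _ , every-block-m) size =
  (λ no-one-point → fewer-than-blocks L m 0<b every-block-m (NoOnePointMeets.rare-block no-one-point)) ,
  (λ large meets → fewer-than-blocks L m 0<b every-block-m (PairwiseMeeting.rare-block size large meets))
  where
  open MinimalSubBIBDs blocks bibd L enumerates
  open Blocks.Ambient blocks bibd using (0<b)
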